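{- Let $(\Omega, \mathcal{R})$ be a $Q$-bipartite $d$-class association scheme (i.e., its Krein parameters satisfy $q_{ij}^h = 0$ whenever $i+j+h$ is odd), with simultaneous eigenspaces $V_0, V_1,\ldots,V_d$ (where $V_0=\langle \mathds{1}\rangle$), and let $\theta$ be a nontrivial subset of the vertices, such that \[ \chi_\theta \in V_0 \perp \left(\perp_{i \in S} V_i\right), \] where $S \subseteq \{1, \ldots, d \}$, such that $i$ is odd for all $i \in S$. Then $|\theta|=\frac{1}{2}|\Omega|$.
   Context: Here $\chi_\theta$ is the characteristic vector of $\theta$, $\perp$ denotes orthogonal direct sum of subspaces, and $\perp_{i \in S} V_i$ denotes the orthogonal direct sum of the eigenspaces $V_i$ for $i\in S$. Nontrivial means $\theta$ is neither empty nor all of $\Omega$. -}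

module Defs where

open import Level using (Level; _⊔_)
open import Data.Nat using (ℕ; zero; suc)
open import Data.Nat as ℕ using ()
open import Data.Fin using (Fin; zero; suc; toℕ; _≟_)
open import Data.Fin.Subset using (Subset; _∈_; _∉_; ∣_∣)
open import Data.Bool using (Bool; true; false; if_then_else_)
open import Data.Product using (Σ; _×_; _,_; ∃; ∃-syntax)
open import Relation.Nullary using (¬_; Dec; yes; no; does)
open import Relation.Binary.PropositionalEquality using (_≡_)
open import Algebra.Bundles using (CommutativeRing)
open import Data.Fin.Subset.Properties using (_∈?_)

Odd : ℕ → Set
Odd m = ∃[ k ] (m ≡ suc (2 ℕ.* k))

count : ∀ {n} → (Fin n → Bool) → ℕ
count {zero}  p = 0
count {suc n} p = (if p zero then 1 else 0) ℕ.+ count (λ z → p (suc z))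

-- Symmetric d-class association scheme on Ω = Fin n.
-- R x y = i means (x , y) ∈ R_i.  Intersection numbers p i j k.

record AssociationScheme (n d : ℕ) : Set where
  field
    R        : Fin n → Fin n → Fin (suc d)
    R0-diag  : ∀ x y → R x y ≡ zero → x ≡ y
    diag-R0  : ∀ x → R x x ≡ zero
    R-sym    : ∀ x y → R x y ≡ R y x
    R-nonempty : ∀ i → ∃[ x ] ∃[ y ] R x y ≡ i
    p        : Fin (suc d) → Fin (suc d) → Fin (suc d) → ℕ
    p-intersection : ∀ i j k x y → R x y ≡ k →
      count (λ z → does (R x z ≟ i) Data.Bool.∧ does (R z y ≟ j)) ≡ p i j k

-- Fields of characteristic zero (the scalars; ℝ is the paper's case)

ringFromℕ : ∀ {c ℓ} (R : CommutativeRing c ℓ) → ℕ → CommutativeRing.Carrier R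
ringFromℕ R zero    = CommutativeRing.0# R
ringFromℕ R (suc k) = CommutativeRing._+_ R (CommutativeRing.1# R) (ringFromℕ R k)

record Char0Field (c ℓ : Level) : Set (Level.suc (c ⊔ ℓ)) where
  field
    scalars : CommutativeRing c ℓ
  open CommutativeRing scalars public
  field
    1≉0     : ¬ (1# ≈ 0#)
    inverse : ∀ x → ¬ (x ≈ 0#) → ∃[ y ] (x * y ≈ 1#)
    char0   : ∀ k → ¬ (ringFromℕ scalars (suc k) ≈ 0#)
  fromℕ : ℕ → Carrier
  fromℕ = ringFromℕ scalars

module LinAlg {c ℓ} (F : Char0Field c ℓ) where
  open Char0Field F using (Carrier; _≈_; _+_; _*_; 0#; 1#; fromℕ)

  Vector : ℕ → Set c
  Vector n = Fin n → Carrier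

  Matrix : ℕ → Set c
  Matrix n = Fin n → Fin n → Carrier

  ∑ : ∀ {m} → (Fin m → Carrier) → Carrier
  ∑ {zero}  f = 0#
  ∑ {suc m} f = f zero + ∑ (λ i → f (suc i))

  _≈ᵥ_ : ∀ {n} → Vector n → Vector n → Set ℓ
  u ≈ᵥ v = ∀ x → u x ≈ v x

  _≈ₘ_ : ∀ {n} → Matrix n → Matrix n → Set ℓ
  M ≈ₘ N = ∀ x y → M x y ≈ N x y

  _·ₘ_ : ∀ {n} → Matrix n → Matrix n → Matrix n
  (M ·ₘ N) x y = ∑ (λ z → M x z * N z y)

  _·ᵥ_ : ∀ {n} → Matrix n → Vector n → Vector n
  (M ·ᵥ v) x = ∑ (λ z → M x z * v z)

  _∘ₘ_ : ∀ {n} → Matrix n → Matrix n → Matrix n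
  (M ∘ₘ N) x y = M x y * N x y

  _⊛_ : ∀ {n} → Carrier → Matrix n → Matrix n
  (a ⊛ M) x y = a * M x y

  ∑ₘ : ∀ {n m} → (Fin m → Matrix n) → Matrix n
  ∑ₘ f x y = ∑ (λ i → f i x y)

  ∑ᵥ : ∀ {n m} → (Fin m → Vector n) → Vector n
  ∑ᵥ f x = ∑ (λ i → f i x)

  𝟘ₘ : ∀ {n} → Matrix n
  𝟘ₘ x y = 0#

  𝟘ᵥ : ∀ {n} → Vector n
  𝟘ᵥ x = 0#

  I : ∀ {n} → Matrix n
  I x y = if does (x ≟ y) then 1# else 0#

  J : ∀ {n} → Matrix n
  J x y = 1#

  χ : ∀ {n} → Subset n → Vector n
  χ θ x = if does (x ∈? θ) then 1# else 0#

  module _ {n d : ℕ} (𝒳 : AssociationScheme n d) where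
    open AssociationScheme 𝒳

    A : Fin (suc d) → Matrix n
    A i x y = if does (R x y ≟ i) then 1# else 0#

    record PrimitiveIdempotents (E : Fin (suc d) → Matrix n) : Set (c ⊔ ℓ) where
      field
        in-BM     : ∀ i → Σ (Fin (suc d) → Carrier) (λ a → E i ≈ₘ ∑ₘ (λ j → a j ⊛ A j))
        idem      : ∀ i → (E i ·ₘ E i) ≈ₘ E i
        orth      : ∀ i j → ¬ (i ≡ j) → (E i ·ₘ E j) ≈ₘ 𝟘ₘ
        nonzero   : ∀ i → ¬ (E i ≈ₘ 𝟘ₘ)
        sum-I     : ∑ₘ E ≈ₘ I
        E0        : (fromℕ n ⊛ E zero) ≈ₘ J

    KreinParameters : (E : Fin (suc d) → Matrix n)
      → (Fin (suc d) → Fin (suc d) → Fin (suc d) → Carrier) → Set ℓ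
    KreinParameters E q = ∀ i j →
      (fromℕ n ⊛ (E i ∘ₘ E j)) ≈ₘ ∑ₘ (λ h → q i j h ⊛ E h)

    QBipartite : (Fin (suc d) → Fin (suc d) → Fin (suc d) → Carrier) → Set ℓ
    QBipartite q = ∀ i j h → Odd (toℕ i ℕ.+ toℕ j ℕ.+ toℕ h) → q i j h ≈ 0#

    -- V i = { v | E i v = v } (the i-th simultaneous eigenspace, the
    -- column space of E i).  v ∈ V 0 ⊥ (⊥_{i ∈ S} V i) means v is a sum
    -- of vectors w i ∈ V i with w i = 0 for i ∉ {0} ∪ S.
    InEigenspaceSum : (E : Fin (suc d) → Matrix n) → Subset (suc d) → Vector n → Set (c ⊔ ℓ)
    InEigenspaceSum E S v = ∃[ w ]
        ( (∀ i → (E i ·ᵥ w i) ≈ᵥ w i)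
        × (∀ i → ¬ (i ≡ zero) → i ∉ S → w i ≈ᵥ 𝟘ᵥ)
        × (v ≈ᵥ ∑ᵥ w) )

{-# OPTIONS --safe #-}
-- Let G = ∑ᵢ (−1)ⁱ Eᵢ (`alternating`). The Krein condition gives
-- |Ω| (G ∘ G) = ∑ₕ (∑ᵢⱼ (−1)ⁱ⁺ʲ qᵢⱼʰ) Eₕ, and Q-bipartiteness lets (−1)ⁱ⁺ʲ be replaced by (−1)ʰ there;
-- expanding |Ω| (I ∘ I) = |Ω| I the same way shows (∑ᵢⱼ qᵢⱼʰ) Eₕ = |Ω| Eₕ, so G ∘ G = G: G is a
-- 0/1 matrix, and E₀ = J/|Ω| makes its row sums 1. Because χ_θ only has components in V₀ and in odd
-- eigenspaces, Gχ_θ + χ_θ = 2E₀χ_θ = (2|θ|/|Ω|)𝟙. At a vertex y ∉ θ the left side counts the 1s of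
-- row y of G that lie in θ, so it is 0 or 1, and θ ≠ ∅ rules out 0; hence 2|θ| = |Ω|.
-- Without decidable equality in the field the entries of G are only ¬¬(0 or 1); this is enough because
-- the conclusion is a decidable equation between natural numbers.
module Submission where

open import Defs
open import Level using (Level)
open import Function using (_∘_)
open import Data.Nat as ℕ using (ℕ; zero; suc; z≤n)
import Data.Nat.Properties as ℕₚ
open import Data.Parity.Base as ℙ using (Parity; 0ℙ; 1ℙ; _⁻¹)
import Data.Parity.Properties as ℙₚ
open import Data.Fin using (Fin; zero; suc; toℕ)
import Data.Fin as Fin
open import Data.Fin.Properties using (punchInᵢ≢i; sequence)
open import Data.Fin.Subset using (Subset; _∈_; _∉_; ∣_∣; inside; outside; _∩_)
open import Data.Fin.Subset.Properties using (_∈?_; ∣p∩q∣≤∣p∣; x∈p⇒∣p-x∣<∣p∣)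
open import Data.Vec using ([]; _∷_)
open import Data.Product using (_×_; _,_; ∃-syntax)
open import Data.Sum using (_⊎_; inj₁; inj₂)
open import Effect.Monad using (RawMonad)
open import Relation.Nullary using (¬_; yes; no)
open import Relation.Nullary.Negation using (contradiction; ¬¬-map; ¬¬-Monad)
open import Relation.Nullary.Decidable using (decidable-stable)
import Relation.Binary.PropositionalEquality as ≡
open ≡ using (_≡_; _≢_)

parity≡1ℙ⇒Odd : ∀ m → ℕ.parity m ≡ 1ℙ → Odd m
parity≡1ℙ⇒Odd 1 _ = 0 , ≡.refl
parity≡1ℙ⇒Odd (suc (suc m)) p with parity≡1ℙ⇒Odd m p
... | k , ≡.refl = suc k , ≡.cong suc (≡.sym (ℕₚ.*-suc 2 k))

Odd⇒parity≡1ℙ : ∀ {m} → Odd m → ℕ.parity m ≡ 1ℙ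
Odd⇒parity≡1ℙ (k , ≡.refl) = ≡.trans (ℙₚ.+-homo-+ 1 (2 ℕ.* k)) (≡.cong _⁻¹ (ℙₚ.*-homo-* 2 k))

parity-+≡0ℙ⇒≡ : ∀ a b → ℕ.parity (a ℕ.+ b) ≡ 0ℙ → ℕ.parity a ≡ ℕ.parity b
parity-+≡0ℙ⇒≡ a b even = ℙₚ.+-cancelʳ-≡ (ℕ.parity b) (ℕ.parity a) (ℕ.parity b)
  (≡.trans (≡.sym (ℙₚ.+-homo-+ a b)) (≡.trans even (≡.sym (ℙₚ.p+p≡0ℙ (ℕ.parity b)))))

n*a≡2t⇒2t≡n : ∀ n {a t} → a ℕ.≤ 1 → 0 ℕ.< t → n ℕ.* a ≡ 2 ℕ.* t → 2 ℕ.* t ≡ n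
n*a≡2t⇒2t≡n n {0} {suc t} _ _ n*0≡2t = contradiction (≡.trans (≡.sym (ℕₚ.*-zeroʳ n)) n*0≡2t) λ ()
n*a≡2t⇒2t≡n n {1} _ _ n*1≡2t = ≡.trans (≡.sym n*1≡2t) (ℕₚ.*-identityʳ n)
n*a≡2t⇒2t≡n n {suc (suc _)} (ℕ.s≤s ()) _ _

module _ {c ℓ} (F : Char0Field c ℓ) where

  open Char0Field F hiding (zero)
  open LinAlg F
  open import Algebra.Definitions _≈_ using (AlmostLeftCancellative)
  open import Algebra.Properties.Ring ring using (+-cancelˡ; -1*x≈-x; -‿involutive)
  open import Algebra.Properties.CommutativeSemigroup *-commutativeSemigroup using (x∙yz≈y∙xz; interchange)
  import Algebra.Properties.Semiring.Mult semiring as Mult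
  import Algebra.Properties.Semiring.Sum semiring as Sum
  open import Relation.Binary.Reasoning.Setoid setoid

  ∑≈sum : ∀ {m} (f : Fin m → Carrier) → ∑ f ≈ Sum.sum f
  ∑≈sum {zero}  f = refl
  ∑≈sum {suc m} f = +-congˡ (∑≈sum (f ∘ suc))

  ∑-cong : ∀ {m} {f g : Fin m → Carrier} → (∀ i → f i ≈ g i) → ∑ f ≈ ∑ g
  ∑-cong {f = f} {g} f≈g = trans (∑≈sum f) (trans (Sum.sum-cong-≋ f≈g) (sym (∑≈sum g)))

  ∑-zero : ∀ {m} {f : Fin m → Carrier} → (∀ i → f i ≈ 0#) → ∑ f ≈ 0#
  ∑-zero {m} f≈0 = trans (∑-cong f≈0) (trans (∑≈sum {m} (λ _ → 0#)) (Sum.sum-replicate-zero m))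

  ∑-distrib-+ : ∀ {m} (f g : Fin m → Carrier) → ∑ (λ i → f i + g i) ≈ ∑ f + ∑ g
  ∑-distrib-+ f g = trans (∑≈sum (λ i → f i + g i))
    (trans (Sum.∑-distrib-+ f g) (sym (+-cong (∑≈sum f) (∑≈sum g))))

  *-distribˡ-∑ : ∀ {m} x (f : Fin m → Carrier) → x * ∑ f ≈ ∑ (λ i → x * f i)
  *-distribˡ-∑ x f = trans (*-congˡ (∑≈sum f)) (trans (Sum.*-distribˡ-sum x f) (sym (∑≈sum (λ i → x * f i))))

  *-distribʳ-∑ : ∀ {m} x (f : Fin m → Carrier) → ∑ f * x ≈ ∑ (λ i → f i * x)
  *-distribʳ-∑ x f = trans (*-congʳ (∑≈sum f)) (trans (Sum.*-distribʳ-sum x f) (sym (∑≈sum (λ i → f i * x))))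

  ∑-comm : ∀ {m k} (f : Fin m → Fin k → Carrier) →
           ∑ (λ i → ∑ (f i)) ≈ ∑ (λ j → ∑ (λ i → f i j))
  ∑-comm f = trans (toSum f) (trans (Sum.∑-comm f) (sym (toSum (λ j i → f i j))))
    where
    toSum : ∀ {m k} (g : Fin m → Fin k → Carrier) → ∑ (λ i → ∑ (g i)) ≈ Sum.sum (λ i → Sum.sum (g i))
    toSum g = trans (∑≈sum (λ i → ∑ (g i))) (Sum.sum-cong-≋ (λ i → ∑≈sum (g i)))

  ∑-select : ∀ {m} {f : Fin m → Carrier} i → (∀ j → j ≢ i → f j ≈ 0#) → ∑ f ≈ f i
  ∑-select {suc m} {f} i others≈0 = begin
    ∑ f                               ≈⟨ ∑≈sum f ⟩
    Sum.sum f                         ≈⟨ Sum.sum-remove {i = i} f ⟩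
    f i + Sum.sum (f ∘ Fin.punchIn i) ≈⟨ +-congˡ (∑≈sum (f ∘ Fin.punchIn i)) ⟨
    f i + ∑ (f ∘ Fin.punchIn i)       ≈⟨ +-congˡ (∑-zero (λ j → others≈0 _ (punchInᵢ≢i i j))) ⟩
    f i + 0#                          ≈⟨ +-identityʳ (f i) ⟩
    f i                               ∎

  ∑-*-∑ : ∀ {m k} (f : Fin m → Carrier) (g : Fin k → Carrier) →
          ∑ f * ∑ g ≈ ∑ (λ i → ∑ (λ j → f i * g j))
  ∑-*-∑ f g = trans (*-distribʳ-∑ (∑ g) f) (∑-cong (λ i → *-distribˡ-∑ (f i) g))

  *-cancelˡ-≉0 : AlmostLeftCancellative 0# _*_
  *-cancelˡ-≉0 a x y a≉0 ax≈ay with inverse a a≉0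
  ... | b , ab≈1 = begin
    x               ≈⟨ sym (*-identityˡ x) ⟩
    1# * x          ≈⟨ *-congʳ (sym ab≈1) ⟩
    (a * b) * x     ≈⟨ *-congʳ (*-comm a b) ⟩
    (b * a) * x     ≈⟨ *-assoc b a x ⟩
    b * (a * x)     ≈⟨ *-congˡ ax≈ay ⟩
    b * (a * y)     ≈⟨ sym (*-assoc b a y) ⟩
    (b * a) * y     ≈⟨ *-congʳ (trans (*-comm b a) ab≈1) ⟩
    1# * y          ≈⟨ *-identityˡ y ⟩
    y               ∎

  idempotent⇒¬¬0⊎1 : ∀ {x} → x * x ≈ x → ¬ ¬ (x ≈ 0# ⊎ x ≈ 1#)
  idempotent⇒¬¬0⊎1 {x} xx≈x ¬0⊎1 =
    ¬0⊎1 (inj₂ (*-cancelˡ-≉0 x x 1# (¬0⊎1 ∘ inj₁) (trans xx≈x (sym (*-identityʳ x)))))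

  fromℕ≈×1# : ∀ k → fromℕ k ≈ k Mult.× 1#
  fromℕ≈×1# zero    = refl
  fromℕ≈×1# (suc k) = +-congˡ (fromℕ≈×1# k)

  fromℕ-homo-* : ∀ a b → fromℕ (a ℕ.* b) ≈ fromℕ a * fromℕ b
  fromℕ-homo-* a b = trans (fromℕ≈×1# (a ℕ.* b))
    (trans (Mult.×1-homo-* a b) (sym (*-cong (fromℕ≈×1# a) (fromℕ≈×1# b))))

  fromℕ-injective : ∀ {a b} → fromℕ a ≈ fromℕ b → a ≡ b
  fromℕ-injective {zero}  {zero}  _ = ≡.refl
  fromℕ-injective {zero}  {suc b} 0≈b+1 = contradiction (sym 0≈b+1) (char0 b)
  fromℕ-injective {suc a} {zero}  a+1≈0 = contradiction a+1≈0 (char0 a)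
  fromℕ-injective {suc a} {suc b} a+1≈b+1 = ≡.cong suc (fromℕ-injective (+-cancelˡ 1# _ _ a+1≈b+1))

  fromℕ≉0 : ∀ {m} → Fin m → ¬ fromℕ m ≈ 0#
  fromℕ≉0 {suc m} _ = char0 m

  ∑-χ : ∀ {m} (p : Subset m) → ∑ (χ p) ≈ fromℕ ∣ p ∣
  ∑-χ []            = refl
  ∑-χ (inside ∷ p)  = +-congˡ (∑-χ p)
  ∑-χ (outside ∷ p) = trans (+-identityˡ _) (∑-χ p)

  χ-∩ : ∀ {m} (p r : Subset m) x → χ (p ∩ r) x ≈ χ p x * χ r x
  χ-∩ (inside ∷ p)  (inside ∷ r)  zero    = sym (*-identityˡ 1#)
  χ-∩ (inside ∷ p)  (outside ∷ r) zero    = sym (*-identityˡ 0#)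
  χ-∩ (outside ∷ p) (_ ∷ r)       zero    = sym (zeroˡ _)
  χ-∩ (_ ∷ p)       (_ ∷ r)       (suc x) = χ-∩ p r x

  χ-∉ : ∀ {m} {p : Subset m} {x} → x ∉ p → χ p x ≈ 0#
  χ-∉ {p = p} {x} x∉p with x ∈? p
  ... | yes x∈p = contradiction x∈p x∉p
  ... | no  _   = refl

  zeroOne⇒χ : ∀ {m} {r : Fin m → Carrier} → (∀ z → r z ≈ 0# ⊎ r z ≈ 1#) → ∃[ ρ ] r ≈ᵥ χ ρ
  zeroOne⇒χ {zero}  _   = [] , λ ()
  zeroOne⇒χ {suc m} r01 with zeroOne⇒χ (r01 ∘ suc) | r01 zero
  ... | ρ , r≈χρ | inj₁ r₀≈0 = outside ∷ ρ , λ { zero → r₀≈0 ; (suc z) → r≈χρ z }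
  ... | ρ , r≈χρ | inj₂ r₀≈1 = inside ∷ ρ , λ { zero → r₀≈1 ; (suc z) → r≈χρ z }

  zeroOne-∑≈1⇒∑-*-χ≤1 : ∀ {m} {r : Fin m → Carrier} → (∀ z → r z ≈ 0# ⊎ r z ≈ 1#) → ∑ r ≈ 1# →
                        ∀ θ → ∃[ a ] a ℕ.≤ 1 × ∑ (λ z → r z * χ θ z) ≈ fromℕ a
  zeroOne-∑≈1⇒∑-*-χ≤1 {r = r} r01 ∑r≈1 θ with zeroOne⇒χ r01
  ... | ρ , r≈χρ = ∣ ρ ∩ θ ∣ , ≡.subst (∣ ρ ∩ θ ∣ ℕ.≤_) ∣ρ∣≡1 (∣p∩q∣≤∣p∣ ρ θ) , ∑r·χθ≈∣ρ∩θ∣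
    where
    ∣ρ∣≡1 : ∣ ρ ∣ ≡ 1
    ∣ρ∣≡1 = fromℕ-injective (begin
      fromℕ ∣ ρ ∣ ≈⟨ ∑-χ ρ ⟨
      ∑ (χ ρ)     ≈⟨ ∑-cong r≈χρ ⟨
      ∑ r         ≈⟨ ∑r≈1 ⟩
      1#          ≈⟨ +-identityʳ 1# ⟨
      fromℕ 1     ∎)
    ∑r·χθ≈∣ρ∩θ∣ : ∑ (λ z → r z * χ θ z) ≈ fromℕ ∣ ρ ∩ θ ∣
    ∑r·χθ≈∣ρ∩θ∣ = trans (∑-cong (λ z → trans (*-congʳ (r≈χρ z)) (sym (χ-∩ ρ θ z)))) (∑-χ (ρ ∩ θ))

  signᴾ : Parity → Carrier
  signᴾ 0ℙ = 1#
  signᴾ 1ℙ = - 1#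

  signᴾ-homo-+ : ∀ p r → signᴾ (p ℙ.+ r) ≈ signᴾ p * signᴾ r
  signᴾ-homo-+ 0ℙ r  = sym (*-identityˡ (signᴾ r))
  signᴾ-homo-+ 1ℙ 0ℙ = sym (*-identityʳ (- 1#))
  signᴾ-homo-+ 1ℙ 1ℙ = sym (trans (-1*x≈-x (- 1#)) (-‿involutive 1#))

  sign : ∀ {m} → Fin m → Carrier
  sign i = signᴾ (ℕ.parity (toℕ i))

  sign-odd : ∀ {m} {i : Fin m} → Odd (toℕ i) → sign i ≈ - 1#
  sign-odd i-odd = reflexive (≡.cong signᴾ (Odd⇒parity≡1ℙ i-odd))

  ·ₘ-congʳ : ∀ {n} {M M′ : Matrix n} (P : Matrix n) → M ≈ₘ M′ → (M ·ₘ P) ≈ₘ (M′ ·ₘ P)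
  ·ₘ-congʳ P M≈M′ x y = ∑-cong (λ z → *-congʳ (M≈M′ x z))

  ·ᵥ-assoc : ∀ {n} (M P : Matrix n) (v : Vector n) → (M ·ᵥ (P ·ᵥ v)) ≈ᵥ ((M ·ₘ P) ·ᵥ v)
  ·ᵥ-assoc M P v x = begin
    ∑ (λ z → M x z * ∑ (λ u → P z u * v u))
      ≈⟨ ∑-cong (λ z → *-distribˡ-∑ (M x z) (λ u → P z u * v u)) ⟩
    ∑ (λ z → ∑ (λ u → M x z * (P z u * v u)))
      ≈⟨ ∑-comm (λ z u → M x z * (P z u * v u)) ⟩
    ∑ (λ u → ∑ (λ z → M x z * (P z u * v u)))
      ≈⟨ ∑-cong (λ u → ∑-cong (λ z → *-assoc (M x z) (P z u) (v u))) ⟨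
    ∑ (λ u → ∑ (λ z → (M x z * P z u) * v u))
      ≈⟨ ∑-cong (λ u → *-distribʳ-∑ (v u) (λ z → M x z * P z u)) ⟨
    ((M ·ₘ P) ·ᵥ v) x
      ∎

  ·ᵥ-∑ᵥ : ∀ {n m} (M : Matrix n) (w : Fin m → Vector n) → (M ·ᵥ ∑ᵥ w) ≈ᵥ ∑ᵥ (λ j → M ·ᵥ w j)
  ·ᵥ-∑ᵥ M w x = trans (∑-cong (λ z → *-distribˡ-∑ (M x z) (λ j → w j z))) (∑-comm (λ z j → M x z * w j z))

  combination-·ᵥ : ∀ {n m} (a : Fin m → Carrier) (M : Fin m → Matrix n) (v : Vector n) x →
                   (∑ₘ (λ i → a i ⊛ M i) ·ᵥ v) x ≈ ∑ (λ i → a i * (M i ·ᵥ v) x)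
  combination-·ᵥ a M v x = begin
    ∑ (λ z → ∑ (λ i → a i * M i x z) * v z)
      ≈⟨ ∑-cong (λ z → *-distribʳ-∑ (v z) (λ i → a i * M i x z)) ⟩
    ∑ (λ z → ∑ (λ i → (a i * M i x z) * v z))
      ≈⟨ ∑-comm (λ z i → (a i * M i x z) * v z) ⟩
    ∑ (λ i → ∑ (λ z → (a i * M i x z) * v z))
      ≈⟨ ∑-cong (λ i → ∑-cong (λ z → *-assoc (a i) (M i x z) (v z))) ⟩
    ∑ (λ i → ∑ (λ z → a i * (M i x z * v z)))
      ≈⟨ ∑-cong (λ i → *-distribˡ-∑ (a i) (λ z → M i x z * v z)) ⟨
    ∑ (λ i → a i * (M i ·ᵥ v) x)
      ∎

  I-∘ₘ-idempotent : ∀ {n} → (I ∘ₘ I) ≈ₘ I {n}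
  I-∘ₘ-idempotent x y with x Fin.≟ y
  ... | yes _ = *-identityˡ 1#
  ... | no  _ = zeroˡ 0#

  module _ {n m} {E : Fin m → Matrix n}
           (idem : ∀ i → (E i ·ₘ E i) ≈ₘ E i)
           (orth : ∀ i j → i ≢ j → (E i ·ₘ E j) ≈ₘ 𝟘ₘ) where

    combination-·ₘ-idempotent : ∀ (a : Fin m → Carrier) k → (∑ₘ (λ h → a h ⊛ E h) ·ₘ E k) ≈ₘ (a k ⊛ E k)
    combination-·ₘ-idempotent a k x y = begin
      (∑ₘ (λ h → a h ⊛ E h) ·ₘ E k) x y ≈⟨ combination-·ᵥ a E (λ z → E k z y) x ⟩
      ∑ (λ h → a h * (E h ·ₘ E k) x y) ≈⟨ ∑-select k (λ h h≢k → trans (*-congˡ (orth h k h≢k x y))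
                                                                      (zeroʳ (a h))) ⟩
      a k * (E k ·ₘ E k) x y           ≈⟨ *-congˡ (idem k x y) ⟩
      a k * E k x y                    ∎

    combination-coefficients : ∀ (a b : Fin m → Carrier) →
      ∑ₘ (λ h → a h ⊛ E h) ≈ₘ ∑ₘ (λ h → b h ⊛ E h) → ∀ k → (a k ⊛ E k) ≈ₘ (b k ⊛ E k)
    combination-coefficients a b a≈b k x y = begin
      a k * E k x y                     ≈⟨ combination-·ₘ-idempotent a k x y ⟨
      (∑ₘ (λ h → a h ⊛ E h) ·ₘ E k) x y ≈⟨ ·ₘ-congʳ (E k) a≈b x y ⟩
      (∑ₘ (λ h → b h ⊛ E h) ·ₘ E k) x y ≈⟨ combination-·ₘ-idempotent b k x y ⟩
      b k * E k x y                     ∎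

    decomposition-component : ∀ {v : Vector n} {w : Fin m → Vector n} →
      (∀ i → (E i ·ᵥ w i) ≈ᵥ w i) → v ≈ᵥ ∑ᵥ w → ∀ i → (E i ·ᵥ v) ≈ᵥ w i
    decomposition-component {v} {w} w∈V v≈∑w i x = begin
      (E i ·ᵥ v) x                 ≈⟨ ·ᵥ-cong v≈∑w ⟩
      (E i ·ᵥ ∑ᵥ w) x              ≈⟨ ·ᵥ-∑ᵥ (E i) w x ⟩
      ∑ (λ j → (E i ·ᵥ w j) x)     ≈⟨ ∑-select i (λ j j≢i → other j (j≢i ∘ ≡.sym)) ⟩
      (E i ·ᵥ w i) x               ≈⟨ w∈V i x ⟩
      w i x                        ∎
      where
      ·ᵥ-cong : ∀ {u u′} → u ≈ᵥ u′ → (E i ·ᵥ u) x ≈ (E i ·ᵥ u′) x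
      ·ᵥ-cong u≈u′ = ∑-cong (λ z → *-congˡ (u≈u′ z))
      other : ∀ j → i ≢ j → (E i ·ᵥ w j) x ≈ 0#
      other j i≢j = begin
        (E i ·ᵥ w j) x               ≈⟨ ·ᵥ-cong (λ z → sym (w∈V j z)) ⟩
        (E i ·ᵥ (E j ·ᵥ w j)) x      ≈⟨ ·ᵥ-assoc (E i) (E j) (w j) x ⟩
        ((E i ·ₘ E j) ·ᵥ w j) x      ≈⟨ ∑-zero (λ z → trans (*-congʳ (orth i j i≢j x z)) (zeroˡ (w j z))) ⟩
        0#                           ∎

  module _ {n d} {𝒳 : AssociationScheme n d} {E : Fin (suc d) → Matrix n}
           (P : PrimitiveIdempotents 𝒳 E) where

    open PrimitiveIdempotents P

    rowSum-E : ∀ i x → ∑ (E i x) ≈ fromℕ n * (E i ·ₘ E zero) x x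
    rowSum-E i x = begin
      ∑ (E i x)
        ≈⟨ ∑-cong (λ z → trans (*-congˡ (E0 z x)) (*-identityʳ (E i x z))) ⟨
      ∑ (λ z → E i x z * (fromℕ n * E zero z x))
        ≈⟨ ∑-cong (λ z → x∙yz≈y∙xz (E i x z) (fromℕ n) (E zero z x)) ⟩
      ∑ (λ z → fromℕ n * (E i x z * E zero z x))
        ≈⟨ *-distribˡ-∑ (fromℕ n) (λ z → E i x z * E zero z x) ⟨
      fromℕ n * (E i ·ₘ E zero) x x
        ∎

    combination-rowSum : ∀ (a : Fin (suc d) → Carrier) x → ∑ (∑ₘ (λ i → a i ⊛ E i) x) ≈ a zero
    combination-rowSum a x = begin
      ∑ (λ z → ∑ (λ i → a i * E i x z))           ≈⟨ ∑-comm (λ z i → a i * E i x z) ⟩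
      ∑ (λ i → ∑ (λ z → a i * E i x z))           ≈⟨ ∑-cong (λ i → *-distribˡ-∑ (a i) (E i x)) ⟨
      ∑ (λ i → a i * ∑ (E i x))                   ≈⟨ ∑-cong (λ i → *-congˡ {a i} (rowSum-E i x)) ⟩
      ∑ (λ i → a i * (fromℕ n * (E i ·ₘ E zero) x x))
        ≈⟨ ∑-select zero (λ i i≢0 → trans (*-congˡ (trans (*-congˡ (orth i zero i≢0 x x)) (zeroʳ (fromℕ n))))
                                          (zeroʳ (a i))) ⟩
      a zero * (fromℕ n * (E zero ·ₘ E zero) x x) ≈⟨ *-congˡ (trans (*-congˡ (idem zero x x)) (E0 x x)) ⟩
      a zero * 1#                                 ≈⟨ *-identityʳ (a zero) ⟩
      a zero                                      ∎

    fromℕ-*-E₀-·ᵥ-χ : ∀ θ x → fromℕ n * (E zero ·ᵥ χ θ) x ≈ fromℕ ∣ θ ∣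
    fromℕ-*-E₀-·ᵥ-χ θ x = begin
      fromℕ n * ∑ (λ z → E zero x z * χ θ z)     ≈⟨ *-distribˡ-∑ (fromℕ n) (λ z → E zero x z * χ θ z) ⟩
      ∑ (λ z → fromℕ n * (E zero x z * χ θ z))   ≈⟨ ∑-cong (λ z → *-assoc (fromℕ n) (E zero x z) (χ θ z)) ⟨
      ∑ (λ z → (fromℕ n * E zero x z) * χ θ z)   ≈⟨ ∑-cong (λ z → *-congʳ (E0 x z)) ⟩
      ∑ (λ z → 1# * χ θ z)                       ≈⟨ ∑-cong (λ z → *-identityˡ (χ θ z)) ⟩
      ∑ (χ θ)                                    ≈⟨ ∑-χ θ ⟩
      fromℕ ∣ θ ∣                                ∎

    alternating : Matrix n
    alternating = ∑ₘ (λ i → sign i ⊛ E i)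

    alternating-rowSum : ∀ x → ∑ (alternating x) ≈ 1#
    alternating-rowSum = combination-rowSum sign

    alternating-·ᵥ : ∀ {S v} → (∀ i → i ∈ S → Odd (toℕ i)) → InEigenspaceSum 𝒳 E S v →
                     ∀ x → (alternating ·ᵥ v) x + v x ≈ (1# + 1#) * (E zero ·ᵥ v) x
    alternating-·ᵥ {S} {v} S-odd (w , w∈V , w-vanish , v≈∑w) x = begin
      (alternating ·ᵥ v) x + v x
        ≈⟨ +-cong (combination-·ᵥ sign E v x) (v≈∑w x) ⟩
      ∑ (λ i → sign i * (E i ·ᵥ v) x) + ∑ (λ i → w i x)
        ≈⟨ +-congʳ (∑-cong (λ i → *-congˡ {sign i} (component i x))) ⟩
      ∑ (λ i → sign i * w i x) + ∑ (λ i → w i x)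
        ≈⟨ ∑-distrib-+ (λ i → sign i * w i x) (λ i → w i x) ⟨
      ∑ (λ i → sign i * w i x + w i x)    ≈⟨ ∑-select zero cancels ⟩
      1# * w zero x + w zero x            ≈⟨ +-congˡ (*-identityˡ (w zero x)) ⟨
      1# * w zero x + 1# * w zero x       ≈⟨ distribʳ (w zero x) 1# 1# ⟨
      (1# + 1#) * w zero x                ≈⟨ *-congˡ (component zero x) ⟨
      (1# + 1#) * (E zero ·ᵥ v) x         ∎
      where
      component : ∀ i → (E i ·ᵥ v) ≈ᵥ w i
      component = decomposition-component idem orth w∈V v≈∑w
      cancels : ∀ i → i ≢ zero → sign i * w i x + w i x ≈ 0#
      cancels i i≢0 with i ∈? S
      ... | yes i∈S = begin
        sign i * w i x + w i x  ≈⟨ +-congʳ (*-congʳ (sign-odd (S-odd i i∈S))) ⟩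
        - 1# * w i x + w i x    ≈⟨ +-congʳ (-1*x≈-x (w i x)) ⟩
        - w i x + w i x         ≈⟨ -‿inverseˡ (w i x) ⟩
        0#                      ∎
      ... | no i∉S = begin
        sign i * w i x + w i x  ≈⟨ +-cong (*-congˡ (w-vanish i i≢0 i∉S x)) (w-vanish i i≢0 i∉S x) ⟩
        sign i * 0# + 0#        ≈⟨ +-identityʳ _ ⟩
        sign i * 0#             ≈⟨ zeroʳ (sign i) ⟩
        0#                      ∎

    twice-size≡n : ∀ {θ S} → (∀ i → i ∈ S → Odd (toℕ i)) → InEigenspaceSum 𝒳 E S (χ θ) →
                   ∀ {x y} → x ∈ θ → y ∉ θ →
                   (∀ z → alternating y z ≈ 0# ⊎ alternating y z ≈ 1#) → 2 ℕ.* ∣ θ ∣ ≡ n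
    twice-size≡n {θ} S-odd χ∈V {x} {y} x∈θ y∉θ row01
      with zeroOne-∑≈1⇒∑-*-χ≤1 row01 (alternating-rowSum y) θ
    ... | a , a≤1 , Gχ≈a = n*a≡2t⇒2t≡n n a≤1 ∣θ∣>0 (fromℕ-injective (begin
      fromℕ (n ℕ.* a)                            ≈⟨ fromℕ-homo-* n a ⟩
      fromℕ n * fromℕ a                          ≈⟨ *-congˡ Gχ≈a ⟨
      fromℕ n * (alternating ·ᵥ χ θ) y           ≈⟨ *-congˡ (trans (+-congˡ (χ-∉ y∉θ)) (+-identityʳ _)) ⟨
      fromℕ n * ((alternating ·ᵥ χ θ) y + χ θ y) ≈⟨ *-congˡ (alternating-·ᵥ S-odd χ∈V y) ⟩
      fromℕ n * ((1# + 1#) * (E zero ·ᵥ χ θ) y)  ≈⟨ x∙yz≈y∙xz (fromℕ n) (1# + 1#) _ ⟩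
      (1# + 1#) * (fromℕ n * (E zero ·ᵥ χ θ) y)  ≈⟨ *-congˡ (fromℕ-*-E₀-·ᵥ-χ θ y) ⟩
      (1# + 1#) * fromℕ ∣ θ ∣                    ≈⟨ *-congʳ (+-congˡ (+-identityʳ 1#)) ⟨
      fromℕ 2 * fromℕ ∣ θ ∣                      ≈⟨ fromℕ-homo-* 2 ∣ θ ∣ ⟨
      fromℕ (2 ℕ.* ∣ θ ∣)                        ∎))
      where
      ∣θ∣>0 : 0 ℕ.< ∣ θ ∣
      ∣θ∣>0 = ℕₚ.≤-<-trans z≤n (x∈p⇒∣p-x∣<∣p∣ x∈θ)

    module _ {q : Fin (suc d) → Fin (suc d) → Fin (suc d) → Carrier} (K : KreinParameters 𝒳 E q) where

      krein-expansion : ∀ (a b : Fin (suc d) → Carrier) →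
        (fromℕ n ⊛ (∑ₘ (λ i → a i ⊛ E i) ∘ₘ ∑ₘ (λ j → b j ⊛ E j)))
          ≈ₘ ∑ₘ (λ h → ∑ (λ i → ∑ (λ j → (a i * b j) * q i j h)) ⊛ E h)
      krein-expansion a b x y = begin
        fromℕ n * (∑ (λ i → a i * e i) * ∑ (λ j → b j * e j))
          ≈⟨ *-congˡ (∑-*-∑ (λ i → a i * e i) (λ j → b j * e j)) ⟩
        fromℕ n * ∑ (λ i → ∑ (λ j → (a i * e i) * (b j * e j)))
          ≈⟨ trans (*-distribˡ-∑ (fromℕ n) (λ i → ∑ (λ j → (a i * e i) * (b j * e j))))
                   (∑-cong (λ i → *-distribˡ-∑ (fromℕ n) (λ j → (a i * e i) * (b j * e j)))) ⟩
        ∑ (λ i → ∑ (λ j → fromℕ n * ((a i * e i) * (b j * e j))))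
          ≈⟨ ∑-cong (λ i → ∑-cong (λ j → trans (*-congˡ (interchange (a i) (e i) (b j) (e j)))
                                                (x∙yz≈y∙xz (fromℕ n) (a i * b j) (e i * e j)))) ⟩
        ∑ (λ i → ∑ (λ j → (a i * b j) * (fromℕ n * (e i * e j))))
          ≈⟨ ∑-cong (λ i → ∑-cong (λ j → *-congˡ {a i * b j} (K i j x y))) ⟩
        ∑ (λ i → ∑ (λ j → (a i * b j) * ∑ (λ h → q i j h * e h)))
          ≈⟨ ∑-cong (λ i → ∑-cong (λ j → trans (*-distribˡ-∑ (a i * b j) (λ h → q i j h * e h))
                                                (∑-cong (λ h → sym (*-assoc (a i * b j) (q i j h) (e h)))))) ⟩
        ∑ (λ i → ∑ (λ j → ∑ (λ h → κ i j h * e h)))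
          ≈⟨ ∑-cong (λ i → ∑-comm (λ j h → κ i j h * e h)) ⟩
        ∑ (λ i → ∑ (λ h → ∑ (λ j → κ i j h * e h)))
          ≈⟨ ∑-comm (λ i h → ∑ (λ j → κ i j h * e h)) ⟩
        ∑ (λ h → ∑ (λ i → ∑ (λ j → κ i j h * e h)))
          ≈⟨ ∑-cong (λ h → trans (*-distribʳ-∑ (e h) (λ i → ∑ (λ j → κ i j h)))
                                   (∑-cong (λ i → *-distribʳ-∑ (e h) (λ j → κ i j h)))) ⟨
        ∑ (λ h → ∑ (λ i → ∑ (λ j → κ i j h)) * e h)
          ∎
        where
        e : Fin (suc d) → Carrier
        e h = E h x y
        κ : Fin (suc d) → Fin (suc d) → Fin (suc d) → Carrier
        κ i j h = (a i * b j) * q i j h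

      totalKrein : Fin (suc d) → Carrier
      totalKrein h = ∑ (λ i → ∑ (λ j → q i j h))

      totalKrein-⊛-E : ∀ h → (totalKrein h ⊛ E h) ≈ₘ (fromℕ n ⊛ E h)
      totalKrein-⊛-E h = combination-coefficients idem orth totalKrein (λ _ → fromℕ n) expansion h
        where
        1*1*q≈q : ∀ i j k → (1# * 1#) * q i j k ≈ q i j k
        1*1*q≈q i j k = trans (*-congʳ (*-identityˡ 1#)) (*-identityˡ (q i j k))
        ∑E≈I : ∀ x y → ∑ (λ i → 1# * E i x y) ≈ I x y
        ∑E≈I x y = trans (∑-cong (λ i → *-identityˡ (E i x y))) (sum-I x y)
        expansion : ∑ₘ (λ k → totalKrein k ⊛ E k) ≈ₘ ∑ₘ (λ k → fromℕ n ⊛ E k)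
        expansion x y = begin
          ∑ (λ k → totalKrein k * E k x y)
            ≈⟨ ∑-cong (λ k → *-congʳ {E k x y} (∑-cong (λ i → ∑-cong (λ j → 1*1*q≈q i j k)))) ⟨
          ∑ (λ k → ∑ (λ i → ∑ (λ j → (1# * 1#) * q i j k)) * E k x y)
            ≈⟨ krein-expansion (λ _ → 1#) (λ _ → 1#) x y ⟨
          fromℕ n * (∑ (λ i → 1# * E i x y) * ∑ (λ j → 1# * E j x y))
            ≈⟨ *-congˡ (*-cong (∑E≈I x y) (∑E≈I x y)) ⟩
          fromℕ n * (I x y * I x y)    ≈⟨ *-congˡ (I-∘ₘ-idempotent x y) ⟩
          fromℕ n * I x y              ≈⟨ *-congˡ (sum-I x y) ⟨
          fromℕ n * ∑ (λ k → E k x y)  ≈⟨ *-distribˡ-∑ (fromℕ n) (λ k → E k x y) ⟩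
          ∑ (λ k → fromℕ n * E k x y)  ∎

      bipartite-sign : QBipartite 𝒳 q → ∀ i j h → (sign i * sign j) * q i j h ≈ sign h * q i j h
      bipartite-sign QB i j h with ℕ.parity (toℕ i ℕ.+ toℕ j ℕ.+ toℕ h) in parity≡
      ... | 0ℙ = *-congʳ (begin
        sign i * sign j
          ≈⟨ signᴾ-homo-+ (ℕ.parity (toℕ i)) (ℕ.parity (toℕ j)) ⟨
        signᴾ (ℕ.parity (toℕ i) ℙ.+ ℕ.parity (toℕ j))
          ≡⟨ ≡.cong signᴾ (ℙₚ.+-homo-+ (toℕ i) (toℕ j)) ⟨
        signᴾ (ℕ.parity (toℕ i ℕ.+ toℕ j))
          ≡⟨ ≡.cong signᴾ (parity-+≡0ℙ⇒≡ (toℕ i ℕ.+ toℕ j) (toℕ h) parity≡) ⟩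
        sign h
          ∎)
      ... | 1ℙ = trans (*-congˡ q≈0) (trans (zeroʳ _) (sym (trans (*-congˡ q≈0) (zeroʳ _))))
        where
        q≈0 : q i j h ≈ 0#
        q≈0 = QB i j h (parity≡1ℙ⇒Odd _ parity≡)

      alternating-∘ₘ-idempotent : QBipartite 𝒳 q → ¬ fromℕ n ≈ 0# →
                                  (alternating ∘ₘ alternating) ≈ₘ alternating
      alternating-∘ₘ-idempotent QB n≉0 x y = *-cancelˡ-≉0 (fromℕ n) _ _ n≉0 (begin
        fromℕ n * (alternating x y * alternating x y)
          ≈⟨ krein-expansion sign sign x y ⟩
        ∑ (λ h → ∑ (λ i → ∑ (λ j → (sign i * sign j) * q i j h)) * E h x y)
          ≈⟨ ∑-cong (λ h → *-congʳ {E h x y} (signed-totalKrein h)) ⟩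
        ∑ (λ h → (sign h * totalKrein h) * E h x y)
          ≈⟨ ∑-cong (λ h → trans (*-assoc (sign h) (totalKrein h) (E h x y)) (*-congˡ (totalKrein-⊛-E h x y))) ⟩
        ∑ (λ h → sign h * (fromℕ n * E h x y))
          ≈⟨ ∑-cong (λ h → x∙yz≈y∙xz (sign h) (fromℕ n) (E h x y)) ⟩
        ∑ (λ h → fromℕ n * (sign h * E h x y))
          ≈⟨ *-distribˡ-∑ (fromℕ n) (λ h → sign h * E h x y) ⟨
        fromℕ n * alternating x y ∎)
        where
        signed-totalKrein : ∀ h → ∑ (λ i → ∑ (λ j → (sign i * sign j) * q i j h)) ≈ sign h * totalKrein h
        signed-totalKrein h = begin
          ∑ (λ i → ∑ (λ j → (sign i * sign j) * q i j h))
            ≈⟨ ∑-cong (λ i → ∑-cong (λ j → bipartite-sign QB i j h)) ⟩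
          ∑ (λ i → ∑ (λ j → sign h * q i j h))
            ≈⟨ ∑-cong (λ i → *-distribˡ-∑ (sign h) (λ j → q i j h)) ⟨
          ∑ (λ i → sign h * ∑ (λ j → q i j h))
            ≈⟨ *-distribˡ-∑ (sign h) (λ i → ∑ (λ j → q i j h)) ⟨
          sign h * totalKrein h
            ∎

      alternating-row-¬¬zeroOne : QBipartite 𝒳 q → ¬ fromℕ n ≈ 0# →
        ∀ y → ¬ ¬ (∀ z → alternating y z ≈ 0# ⊎ alternating y z ≈ 1#)
      alternating-row-¬¬zeroOne QB n≉0 y = sequence (RawMonad.rawApplicative ¬¬-Monad)
        (λ z → idempotent⇒¬¬0⊎1 (alternating-∘ₘ-idempotent QB n≉0 y z))

-- Imported only here because inside the module above _*_ is the field multiplication.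
open import Data.Nat using (_*_)

theorem4p4 : ∀ {c ℓ : Level} (F : Char0Field c ℓ) {n d : ℕ}
    (𝒳 : AssociationScheme n d)
    (E : Fin (suc d) → LinAlg.Matrix F n)
    → LinAlg.PrimitiveIdempotents F 𝒳 E
    → (q : Fin (suc d) → Fin (suc d) → Fin (suc d) → Char0Field.Carrier F)
    → LinAlg.KreinParameters F 𝒳 E q
    → LinAlg.QBipartite F 𝒳 q
    → (θ : Subset n)
    → (∃[ x ] x ∈ θ) → (∃[ y ] y ∉ θ)
    → (S : Subset (suc d))
    → zero ∉ S
    → (∀ i → i ∈ S → Odd (toℕ i))
    → LinAlg.InEigenspaceSum F 𝒳 E S (LinAlg.χ F θ)
    → 2 * ∣ θ ∣ ≡ n
theorem4p4 F 𝒳 E P q K QB θ (x , x∈θ) (y , y∉θ) S _ S-odd χ∈V =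
  decidable-stable (2 * ∣ θ ∣ ℕ.≟ _)
    (¬¬-map (twice-size≡n F P S-odd χ∈V x∈θ y∉θ)
            (alternating-row-¬¬zeroOne F P K QB (fromℕ≉0 F x) y))
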